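{- Let $f:\{0,1\}^n\to\{0,1\}$ be a Boolean function. Then $D^{AND}(f)\ge\log_3(|mon(f)|)$.
   Context: $mon(f)$ is the set of subsets $S\subseteq[n]$ whose coefficient $a_S$ in the unique multilinear real polynomial $f=\sum_S a_S\prod_{i\in S}x_i$ is nonzero. An AND decision tree is a binary tree whose internal nodes are labeled by functions $\bigwedge_{i\in S}x_i$ for arbitrary $S\subseteq[n]$ and whose leaves are labeled $0/1$; it computes $f$ if for every input the path determined by the node values (right on 1, left on 0) ends at a leaf labeled $f(x)$. $D^{AND}(f)$ is the minimum depth of an AND decision tree computing $f$. -}

module Defs where

open import Data.Bool using (Bool; true; false; _∧_; _∨_; not; if_then_else_)
open import Data.Nat using (ℕ; zero; suc; _⊔_)
open import Data.Integer using (ℤ; _+_; _*_; 0ℤ; 1ℤ)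
import Data.Integer as ℤ
open import Data.Fin using (Fin; zero; suc)
open import Data.Fin.Subset using (Subset)
open import Data.Vec using (Vec; []; _∷_)
open import Data.List using (List; []; _∷_; map; _++_; length; filter; foldr)
open import Relation.Nullary using (¬?)
open import Relation.Binary.PropositionalEquality using (_≡_)

Input : ℕ → Set
Input n = Fin n → Bool

BoolFun : ℕ → Set
BoolFun n = Input n → Bool

andS : ∀ {n} → Subset n → Input n → Bool
andS [] x = true
andS (b ∷ S) x = (not b ∨ x zero) ∧ andS S (λ i → x (suc i))

allSubsets : (n : ℕ) → List (Subset n)
allSubsets zero = [] ∷ []
allSubsets (suc n) = map (false ∷_) (allSubsets n) ++ map (true ∷_) (allSubsets n)

toℤ : Bool → ℤ
toℤ true = 1ℤ
toℤ false = 0ℤ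

evalPoly : ∀ {n} → (Subset n → ℤ) → Input n → ℤ
evalPoly {n} a x = foldr (λ S acc → a S * toℤ (andS S x) + acc) 0ℤ (allSubsets n)

Represents : ∀ {n} → (Subset n → ℤ) → BoolFun n → Set
Represents a f = ∀ x → toℤ (f x) ≡ evalPoly a x

-- |{S : a_S ≠ 0}|, i.e. |mon(f)| when a represents f.
monCount : ∀ {n} → (Subset n → ℤ) → ℕ
monCount {n} a = length (filter (λ S → ¬? (a S ℤ.≟ 0ℤ)) (allSubsets n))

data AndTree (n : ℕ) : Set where
  leaf : Bool → AndTree n
  node : Subset n → AndTree n → AndTree n → AndTree n   -- node S left(=0) right(=1)

runTree : ∀ {n} → AndTree n → Input n → Bool
runTree (leaf b) x = b
runTree (node S l r) x = if andS S x then runTree r x else runTree l x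

depth : ∀ {n} → AndTree n → ℕ
depth (leaf _) = zero
depth (node _ l r) = suc (depth l ⊔ depth r)

Computes : ∀ {n} → AndTree n → BoolFun n → Set
Computes T f = ∀ x → runTree T x ≡ f x

-- A depth-d AND decision tree computes the polynomial p_T given by p_leaf = b and
-- p_(node S l r) = p_l + (∏_{i∈S} x_i)·(p_r − p_l).  Multiplying a multilinear polynomial
-- by a monomial and multilinearising (x_i² = x_i) never creates monomials, so
-- |mon p_T| ≤ |mon p_l| + |mon p_r| + |mon p_l| ≤ 3^d.  Since the multilinear representation
-- of a function on {0,1}^n is unique, p_T has the coefficients of f.
module Submission where

open import Defs
open import Data.Nat using (ℕ; _≤_; _^_)
open import Data.Integer using (ℤ)
open import Data.Fin.Subset using (Subset)

import Algebra.Properties.AbelianGroup as AbelianGroupProperties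
import Algebra.Properties.CommutativeSemigroup as CommutativeSemigroupProperties
open import Data.Bool using (true; false; if_then_else_; _∧_)
open import Data.Integer using (+_; -[1+_]; +0; 0ℤ; _+_; _*_; -_; _≟_)
import Data.Integer.Properties as ℤ
open import Data.Integer.Tactic.RingSolver using (solve-∀)
open import Data.List using (List; []; _∷_; map; _++_; length; filter; foldr)
open import Data.List.Properties using (filter-++; length-++; foldr-map)
open import Data.Nat using (zero; suc; _⊔_; z≤n) renaming (_+_ to _+ℕ_)
import Data.Nat.Properties as ℕ
open import Data.Vec using ([]; _∷_)
open import Data.Vec.Functional using (head; tail) renaming (_∷_ to _∷ᶠ_)
open import Function using (_∘_)
open import Relation.Nullary using (¬?; does)
open import Relation.Unary using (Pred; Decidable)
open import Relation.Binary.PropositionalEquality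

private
  variable
    n : ℕ

open CommutativeSemigroupProperties ℤ.+-commutativeSemigroup
  using () renaming (interchange to +-interchange)
open CommutativeSemigroupProperties ℕ.+-commutativeSemigroup
  using () renaming (interchange to +ℕ-interchange)
open AbelianGroupProperties ℤ.+-0-abelianGroup using (∙-cancelˡ)

Coeffs : ℕ → Set
Coeffs n = Subset n → ℤ

lower upper : Coeffs (suc n) → Coeffs n
lower a S = a (false ∷ S)
upper a S = a (true ∷ S)

eval : Coeffs n → Input n → ℤ
eval {zero}  a x = a []
eval {suc n} a x =
  if head x then eval (lower a) (tail x) + eval (upper a) (tail x)
            else eval (lower a) (tail x)

count≢0 : ℤ → ℕ
count≢0 +0 = 0
count≢0 _  = 1

#mon : Coeffs n → ℕ
#mon {zero}  a = count≢0 (a [])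
#mon {suc n} a = #mon (lower a) +ℕ #mon (upper a)

0ₚ : Coeffs n
0ₚ _ = 0ℤ

constant : ℤ → Coeffs n
constant {zero}  c []          = c
constant {suc n} c (false ∷ S) = constant c S
constant {suc n} c (true  ∷ S) = 0ℤ

_+ₚ_ : Coeffs n → Coeffs n → Coeffs n
(a +ₚ b) S = a S + b S

-ₚ_ : Coeffs n → Coeffs n
(-ₚ a) S = - a S

mulMonomial : Subset n → Coeffs n → Coeffs n
mulMonomial []          a              = a
mulMonomial (false ∷ S) a (false ∷ T) = mulMonomial S (lower a) T
mulMonomial (false ∷ S) a (true  ∷ T) = mulMonomial S (upper a) T
mulMonomial (true  ∷ S) a (false ∷ T) = 0ℤ
-- x₀ · (p₀ + x₀ p₁) = x₀ (p₀ + p₁), because x₀² = x₀ on Boolean inputs.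
mulMonomial (true  ∷ S) a (true  ∷ T) = mulMonomial S (lower a +ₚ upper a) T

eval-0ₚ : ∀ x → eval {n} 0ₚ x ≡ 0ℤ
eval-0ₚ {zero}  x = refl
eval-0ₚ {suc n} x with head x
... | true  rewrite eval-0ₚ {n} (tail x) = refl
... | false = eval-0ₚ {n} (tail x)

eval-constant : ∀ c x → eval {n} (constant c) x ≡ c
eval-constant {zero}  c x = refl
eval-constant {suc n} c x with head x
... | true  rewrite eval-constant {n} c (tail x) | eval-0ₚ {n} (tail x) = ℤ.+-identityʳ c
... | false = eval-constant {n} c (tail x)

eval-+ₚ : ∀ (a b : Coeffs n) x → eval (a +ₚ b) x ≡ eval a x + eval b x
eval-+ₚ {zero}  a b x = refl
eval-+ₚ {suc n} a b x with head x
... | true  rewrite eval-+ₚ (lower a) (lower b) (tail x) | eval-+ₚ (upper a) (upper b) (tail x) =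
  +-interchange (eval (lower a) (tail x)) (eval (lower b) (tail x))
                (eval (upper a) (tail x)) (eval (upper b) (tail x))
... | false = eval-+ₚ (lower a) (lower b) (tail x)

eval--ₚ : ∀ (a : Coeffs n) x → eval (-ₚ a) x ≡ - eval a x
eval--ₚ {zero}  a x = refl
eval--ₚ {suc n} a x with head x
... | true  rewrite eval--ₚ (lower a) (tail x) | eval--ₚ (upper a) (tail x) =
  sym (ℤ.neg-distrib-+ (eval (lower a) (tail x)) (eval (upper a) (tail x)))
... | false = eval--ₚ (lower a) (tail x)

eval-mulMonomial : ∀ (S : Subset n) a x →
                   eval (mulMonomial S a) x ≡ (if andS S x then eval a x else 0ℤ)
eval-mulMonomial [] a x = refl
eval-mulMonomial (false ∷ S) a x
  rewrite eval-mulMonomial S (lower a) (tail x) | eval-mulMonomial S (upper a) (tail x)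
  with head x | andS S (tail x)
... | true  | true  = refl
... | true  | false = refl
... | false | _     = refl
eval-mulMonomial {suc n} (true ∷ S) a x
  rewrite eval-mulMonomial S (lower a +ₚ upper a) (tail x) | eval-0ₚ {n} (tail x)
  with head x
... | false = refl
... | true  with andS S (tail x)
...   | true  = trans (ℤ.+-identityˡ _) (eval-+ₚ (lower a) (upper a) (tail x))
...   | false = refl

count≢0-≤1 : ∀ z → count≢0 z ≤ 1
count≢0-≤1 +0           = z≤n
count≢0-≤1 (+ suc _)    = ℕ.≤-refl
count≢0-≤1 -[1+ _ ]     = ℕ.≤-refl

count≢0-+ : ∀ p q → count≢0 (p + q) ≤ count≢0 p +ℕ count≢0 q
count≢0-+ +0 q rewrite ℤ.+-identityˡ q = ℕ.≤-refl
count≢0-+ p@(+ suc _) q = ℕ.≤-trans (count≢0-≤1 (p + q)) (ℕ.m≤m+n 1 (count≢0 q))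
count≢0-+ p@(-[1+ _ ]) q = ℕ.≤-trans (count≢0-≤1 (p + q)) (ℕ.m≤m+n 1 (count≢0 q))

count≢0-neg : ∀ p → count≢0 (- p) ≡ count≢0 p
count≢0-neg +0         = refl
count≢0-neg (+ suc _)  = refl
count≢0-neg -[1+ _ ]   = refl

#mon-0ₚ : #mon {n} 0ₚ ≡ 0
#mon-0ₚ {zero}  = refl
#mon-0ₚ {suc n} rewrite #mon-0ₚ {n} = refl

#mon-constant : ∀ c → #mon {n} (constant c) ≤ 1
#mon-constant {zero}  c = count≢0-≤1 c
#mon-constant {suc n} c rewrite #mon-0ₚ {n} | ℕ.+-identityʳ (#mon {n} (constant c)) =
  #mon-constant {n} c

#mon-+ₚ : ∀ (a b : Coeffs n) → #mon (a +ₚ b) ≤ #mon a +ℕ #mon b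
#mon-+ₚ {zero}  a b = count≢0-+ (a []) (b [])
#mon-+ₚ {suc n} a b = begin
  #mon (lower a +ₚ lower b) +ℕ #mon (upper a +ₚ upper b)
    ≤⟨ ℕ.+-mono-≤ (#mon-+ₚ (lower a) (lower b)) (#mon-+ₚ (upper a) (upper b)) ⟩
  (#mon (lower a) +ℕ #mon (lower b)) +ℕ (#mon (upper a) +ℕ #mon (upper b))
    ≡⟨ +ℕ-interchange (#mon (lower a)) (#mon (lower b)) (#mon (upper a)) (#mon (upper b)) ⟩
  #mon a +ℕ #mon b ∎
  where open ℕ.≤-Reasoning

#mon--ₚ : ∀ (a : Coeffs n) → #mon (-ₚ a) ≡ #mon a
#mon--ₚ {zero}  a = count≢0-neg (a [])
#mon--ₚ {suc n} a = cong₂ _+ℕ_ (#mon--ₚ (lower a)) (#mon--ₚ (upper a))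

#mon-mulMonomial : ∀ (S : Subset n) a → #mon (mulMonomial S a) ≤ #mon a
#mon-mulMonomial []          a = ℕ.≤-refl
#mon-mulMonomial (false ∷ S) a =
  ℕ.+-mono-≤ (#mon-mulMonomial S (lower a)) (#mon-mulMonomial S (upper a))
#mon-mulMonomial {suc n} (true ∷ S) a rewrite #mon-0ₚ {n} =
  ℕ.≤-trans (#mon-mulMonomial S (lower a +ₚ upper a)) (#mon-+ₚ (lower a) (upper a))

eval-injective : ∀ (a b : Coeffs n) → (∀ x → eval a x ≡ eval b x) → a ≗ b
eval-injective {zero}  a b eq [] = eq (λ ())
eval-injective {suc n} a b eq (false ∷ S) =
  eval-injective (lower a) (lower b) (eq ∘ (false ∷ᶠ_)) S
eval-injective {suc n} a b eq (true ∷ S) = eval-injective (upper a) (upper b) upperEq S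
  where
  upperEq : ∀ x → eval (upper a) x ≡ eval (upper b) x
  upperEq x = ∙-cancelˡ (eval (lower a) x) _ _
    (trans (eq (true ∷ᶠ x))
           (cong (_+ eval (upper b) x) (sym (eq (false ∷ᶠ x)))))

#mon-cong : ∀ {a b : Coeffs n} → a ≗ b → #mon a ≡ #mon b
#mon-cong {zero}  eq = cong count≢0 (eq [])
#mon-cong {suc n} eq = cong₂ _+ℕ_ (#mon-cong (eq ∘ (false ∷_))) (#mon-cong (eq ∘ (true ∷_)))

treePoly : AndTree n → Coeffs n
treePoly (leaf b)     = constant (toℤ b)
treePoly (node S l r) = treePoly l +ₚ mulMonomial S (treePoly r +ₚ (-ₚ treePoly l))

eval-treePoly : ∀ (T : AndTree n) x → eval (treePoly T) x ≡ toℤ (runTree T x)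
eval-treePoly {n} (leaf b) x = eval-constant {n} (toℤ b) x
eval-treePoly (node S l r) x
  rewrite eval-+ₚ (treePoly l) (mulMonomial S (treePoly r +ₚ (-ₚ treePoly l))) x
        | eval-mulMonomial S (treePoly r +ₚ (-ₚ treePoly l)) x
  with andS S x
... | true  rewrite eval-+ₚ (treePoly r) (-ₚ treePoly l) x | eval--ₚ (treePoly l) x
                  | eval-treePoly l x | eval-treePoly r x =
  +-minus-cancel (toℤ (runTree l x)) (toℤ (runTree r x))
  where
  +-minus-cancel : ∀ p q → p + (q + - p) ≡ q
  +-minus-cancel = solve-∀
... | false rewrite eval-treePoly l x = ℤ.+-identityʳ _

#mon-treePoly : ∀ (T : AndTree n) → #mon (treePoly T) ≤ 3 ^ depth T
#mon-treePoly {n} (leaf b) = #mon-constant {n} (toℤ b)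
#mon-treePoly (node S l r) = begin
  #mon (pl +ₚ mulMonomial S (pr +ₚ (-ₚ pl)))
    ≤⟨ #mon-+ₚ pl (mulMonomial S (pr +ₚ (-ₚ pl))) ⟩
  #mon pl +ℕ #mon (mulMonomial S (pr +ₚ (-ₚ pl)))
    ≤⟨ ℕ.+-monoʳ-≤ (#mon pl) (#mon-mulMonomial S (pr +ₚ (-ₚ pl))) ⟩
  #mon pl +ℕ #mon (pr +ₚ (-ₚ pl))
    ≤⟨ ℕ.+-monoʳ-≤ (#mon pl) (#mon-+ₚ pr (-ₚ pl)) ⟩
  #mon pl +ℕ (#mon pr +ℕ #mon (-ₚ pl))
    ≡⟨ cong (λ k → #mon pl +ℕ (#mon pr +ℕ k)) (#mon--ₚ pl) ⟩
  #mon pl +ℕ (#mon pr +ℕ #mon pl)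
    ≤⟨ ℕ.+-mono-≤ bound-l (ℕ.+-mono-≤ bound-r (ℕ.≤-trans bound-l (ℕ.m≤m+n _ 0))) ⟩
  3 ^ suc d ∎
  where
  open ℕ.≤-Reasoning
  pl = treePoly l
  pr = treePoly r
  d  = depth l ⊔ depth r
  bound-l : #mon pl ≤ 3 ^ d
  bound-l = ℕ.≤-trans (#mon-treePoly l) (ℕ.^-monoʳ-≤ 3 (ℕ.m≤m⊔n (depth l) (depth r)))
  bound-r : #mon pr ≤ 3 ^ d
  bound-r = ℕ.≤-trans (#mon-treePoly r) (ℕ.^-monoʳ-≤ 3 (ℕ.m≤n⊔m (depth l) (depth r)))

sumℤ : ∀ {A : Set} → (A → ℤ) → List A → ℤ
sumℤ g = foldr (λ S acc → g S + acc) 0ℤ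

sumℤ-++ : ∀ {A : Set} (g : A → ℤ) xs ys → sumℤ g (xs ++ ys) ≡ sumℤ g xs + sumℤ g ys
sumℤ-++ g []       ys = sym (ℤ.+-identityˡ _)
sumℤ-++ g (x ∷ xs) ys rewrite sumℤ-++ g xs ys = sym (ℤ.+-assoc (g x) _ _)

sumℤ-≗0 : ∀ {A : Set} (g : A → ℤ) → (∀ y → g y ≡ 0ℤ) → ∀ xs → sumℤ g xs ≡ 0ℤ
sumℤ-≗0 g g≗0 []       = refl
sumℤ-≗0 g g≗0 (x ∷ xs) rewrite g≗0 x | sumℤ-≗0 g g≗0 xs = refl

evalPoly-∷ : ∀ (a : Coeffs (suc n)) x →
             evalPoly a x ≡ evalPoly (lower a) (tail x)
                          + (if head x then evalPoly (upper a) (tail x) else 0ℤ)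
evalPoly-∷ {n} a x = begin
  evalPoly a x
    ≡⟨ sumℤ-++ g (map (false ∷_) L) (map (true ∷_) L) ⟩
  sumℤ g (map (false ∷_) L) + sumℤ g (map (true ∷_) L)
    ≡⟨ cong₂ _+_ (foldr-map _ (false ∷_) 0ℤ L) (foldr-map _ (true ∷_) 0ℤ L) ⟩
  evalPoly (lower a) (tail x) + sumℤ (λ S → upper a S * toℤ (head x ∧ andS S (tail x))) L
    ≡⟨ cong (_+_ (evalPoly (lower a) (tail x))) (upper-part (head x)) ⟩
  evalPoly (lower a) (tail x) + (if head x then evalPoly (upper a) (tail x) else 0ℤ) ∎
  where
  open ≡-Reasoning
  L = allSubsets n
  g : Subset (suc n) → ℤ
  g S = a S * toℤ (andS S x)
  upper-part : ∀ b → sumℤ (λ S → upper a S * toℤ (b ∧ andS S (tail x))) L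
                   ≡ (if b then evalPoly (upper a) (tail x) else 0ℤ)
  upper-part true  = refl
  upper-part false = sumℤ-≗0 _ (λ S → ℤ.*-zeroʳ (upper a S)) L

evalPoly≡eval : ∀ (a : Coeffs n) x → evalPoly a x ≡ eval a x
evalPoly≡eval {zero}  a x = trans (ℤ.+-identityʳ _) (ℤ.*-identityʳ _)
evalPoly≡eval {suc n} a x
  rewrite evalPoly-∷ a x | evalPoly≡eval (lower a) (tail x) | evalPoly≡eval (upper a) (tail x)
  with head x
... | true  = refl
... | false = ℤ.+-identityʳ _

length-filter-map : ∀ {a b p} {A : Set a} {B : Set b} {P : Pred B p} (P? : Decidable P)
                    (f : A → B) xs → length (filter P? (map f xs)) ≡ length (filter (P? ∘ f) xs)
length-filter-map P? f []       = refl
length-filter-map P? f (x ∷ xs) with does (P? (f x))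
... | true  = cong suc (length-filter-map P? f xs)
... | false = length-filter-map P? f xs

monCount-∷ : ∀ (a : Coeffs (suc n)) → monCount a ≡ monCount (lower a) +ℕ monCount (upper a)
monCount-∷ {n} a = begin
  length (filter P? (map (false ∷_) L ++ map (true ∷_) L))
    ≡⟨ cong length (filter-++ P? (map (false ∷_) L) (map (true ∷_) L)) ⟩
  length (filter P? (map (false ∷_) L) ++ filter P? (map (true ∷_) L))
    ≡⟨ length-++ (filter P? (map (false ∷_) L)) ⟩
  length (filter P? (map (false ∷_) L)) +ℕ length (filter P? (map (true ∷_) L))
    ≡⟨ cong₂ _+ℕ_ (length-filter-map P? (false ∷_) L) (length-filter-map P? (true ∷_) L) ⟩
  monCount (lower a) +ℕ monCount (upper a) ∎
  where
  open ≡-Reasoning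
  L = allSubsets n
  P? = λ (S : Subset (suc n)) → ¬? (a S ≟ 0ℤ)

monCount≡#mon : ∀ (a : Coeffs n) → monCount a ≡ #mon a
monCount≡#mon {zero}  a with a []
... | +0         = refl
... | + suc _    = refl
... | -[1+ _ ]   = refl
monCount≡#mon {suc n} a =
  trans (monCount-∷ a) (cong₂ _+ℕ_ (monCount≡#mon (lower a)) (monCount≡#mon (upper a)))

eval-treePoly-agrees : ∀ {f : BoolFun n} {a : Coeffs n} → Represents a f →
                       (T : AndTree n) → Computes T f → ∀ x → eval a x ≡ eval (treePoly T) x
eval-treePoly-agrees {f = f} {a} rep T comp x = begin
  eval a x                   ≡⟨ evalPoly≡eval a x ⟨
  evalPoly a x               ≡⟨ rep x ⟨
  toℤ (f x)                  ≡⟨ cong toℤ (comp x) ⟨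
  toℤ (runTree T x)          ≡⟨ eval-treePoly T x ⟨
  eval (treePoly T) x        ∎
  where open ≡-Reasoning

lemma3p21 : (n : ℕ) (f : BoolFun n) (a : Subset n → ℤ) → Represents a f →
    (T : AndTree n) → Computes T f → monCount a ≤ 3 ^ depth T
lemma3p21 n f a rep T comp = begin
  monCount a         ≡⟨ monCount≡#mon a ⟩
  #mon a             ≡⟨ #mon-cong (eval-injective a (treePoly T) (eval-treePoly-agrees rep T comp)) ⟩
  #mon (treePoly T)  ≤⟨ #mon-treePoly T ⟩
  3 ^ depth T        ∎
  where open ℕ.≤-Reasoning
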